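{- Let $A,B$ be process templates and consider conjunctive systems. For every $n \geq 1$: if $(A,B)^{(1,n)}$ has a deadlock, then $(A,B)^{(1,n+1)}$ has a deadlock.
   Context: A process template is $U=(Q_U,\mathrm{init}_U,\Sigma_U,\delta_U)$ with finite state set $Q_U$ containing initial state $\mathrm{init}_U$, finite input alphabet $\Sigma_U$, and guarded transition relation $\delta_U \subseteq Q_U \times \Sigma_U \times \mathcal{P}(Q_A \cup Q_B) \times Q_U$. $Q_A,Q_B$ are disjoint, as are the alphabets. The system $(A,B)^{(1,n)}$ consists of one copy of $A$ and $n$ copies $B_1,\dots,B_n$ of $B$ in interleaving composition, starting with all processes in their initial states. A local transition $(q,\sigma,g,q')$ of process $p$ is enabled in global state $s$ with global input $e$ if $s(p)=q$, $e(p)=\sigma$ and (conjunctive interpretation) every process $p'\neq p$ has $s(p')\in g$; $\mathrm{init}_A,\mathrm{init}_B$ belong to every guard. A process is enabled if one of its transitions is enabled; each global step moves exactly one process along an enabled local transition. A run is a maximal sequence of configurations $(s_t,e_t,p_t)$ from the initial state ($p_t$ is the moving process; a configuration $(s,e,\bot)$ occurs exactly when all processes are disabled, ending the run), in which a process's input changes only at moments at which that process moves. A run is globally deadlocked if it is finite, locally deadlocked if it is infinite and some process is disabled at all moments from some point on; a system has a deadlock if it has a locally or globally deadlocked run. -}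

module Defs where

open import Data.Nat using (ℕ; zero; suc; _<_; _≤_)
open import Data.Fin using (Fin)
open import Data.Bool using (Bool; true)
open import Data.Sum using (_⊎_; inj₁; inj₂)
open import Data.Product using (Σ; _×_; _,_; ∃)
open import Data.List using (List)
open import Data.List.Membership.Propositional using (_∈_)
open import Relation.Binary.PropositionalEquality using (_≡_; _≢_)
open import Relation.Nullary using (¬_)

-- A guard is a subset of Q_A ∪ Q_B (disjoint union), Q_A = Fin kA, Q_B = Fin kB.
Guard : ℕ → ℕ → Set
Guard kA kB = Fin kA ⊎ Fin kB → Bool

-- The transition relation is a finite set of
-- guarded transitions (q, σ, g, q'), given as a list.
record Transition (kA kB k nΣ : ℕ) : Set where
  constructor trans
  field
    src   : Fin k
    sym   : Fin nΣ
    guard : Guard kA kB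
    tgt   : Fin k

record Template (kA kB k : ℕ) : Set where
  field
    init : Fin k
    nΣ   : ℕ
    δ    : List (Transition kA kB k nΣ)

open Transition public
open Template public

InitInGuards : ∀ {kA kB} → Template kA kB kA → Template kA kB kB → Set
InitInGuards {kA} {kB} A B =
  (∀ τ → τ ∈ δ A → guard τ (inj₁ (init A)) ≡ true × guard τ (inj₂ (init B)) ≡ true) ×
  (∀ τ → τ ∈ δ B → guard τ (inj₁ (init A)) ≡ true × guard τ (inj₂ (init B)) ≡ true)

-- Processes of (A,B)^(1,n): the single copy of A and copies B_1..B_n.
data Proc (n : ℕ) : Set where
  pA : Proc n
  pB : Fin n → Proc n

module System {kA kB : ℕ} (A : Template kA kB kA) (B : Template kA kB kB) where

  kOf : ∀ {n} → Proc n → ℕ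
  kOf pA     = kA
  kOf (pB _) = kB

  tmpl : ∀ {n} (p : Proc n) → Template kA kB (kOf p)
  tmpl pA     = A
  tmpl (pB _) = B

  St : ∀ {n} → Proc n → Set
  St p = Fin (kOf p)

  Inp : ∀ {n} → Proc n → Set
  Inp p = Fin (nΣ (tmpl p))

  loc : ∀ {n} (p : Proc n) → St p → Fin kA ⊎ Fin kB
  loc pA     q = inj₁ q
  loc (pB _) q = inj₂ q

  GState : ℕ → Set
  GState n = (p : Proc n) → St p

  GInput : ℕ → Set
  GInput n = (p : Proc n) → Inp p

  initState : ∀ {n} → GState n
  initState p = init (tmpl p)

  -- local transition τ of process p is enabled in s with input e
  -- (conjunctive interpretation)
  TransEnabled : ∀ {n} → GState n → GInput n → (p : Proc n) →
                 Transition kA kB (kOf p) (nΣ (tmpl p)) → Set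
  TransEnabled s e p τ =
    src τ ≡ s p × sym τ ≡ e p ×
    (∀ p' → p' ≢ p → guard τ (loc p' (s p')) ≡ true)

  Enabled : ∀ {n} → GState n → GInput n → Proc n → Set
  Enabled s e p = Σ _ λ τ → τ ∈ δ (tmpl p) × TransEnabled s e p τ

  Step : ∀ {n} → GState n → GInput n → Proc n → GState n → Set
  Step s e p s' = Σ _ λ τ → τ ∈ δ (tmpl p) × TransEnabled s e p τ ×
                  s' p ≡ tgt τ × (∀ p' → p' ≢ p → s' p' ≡ s p')

  StepAt : ∀ {n} → (ℕ → GState n) → (ℕ → GInput n) → (ℕ → Proc n) → ℕ → Set
  StepAt s e p t = Step (s t) (e t) (p t) (s (suc t)) ×
                   (∀ q → q ≢ p t → e (suc t) q ≡ e t q)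

  -- a finite run of (A,B)^(1,n): configurations (s t, e t, p t) for t < k,
  -- ending in (s k, e k, ⊥) where all processes are disabled.
  -- Finite runs are exactly the globally deadlocked runs.
  GloballyDeadlockedRun : ℕ → Set
  GloballyDeadlockedRun n =
    Σ ℕ λ k → Σ (ℕ → GState n) λ s → Σ (ℕ → GInput n) λ e → Σ (ℕ → Proc n) λ p →
      s 0 ≡ initState × (∀ t → t < k → StepAt s e p t) ×
      (∀ q → ¬ Enabled (s k) (e k) q)

  LocallyDeadlockedRun : ℕ → Set
  LocallyDeadlockedRun n =
    Σ (ℕ → GState n) λ s → Σ (ℕ → GInput n) λ e → Σ (ℕ → Proc n) λ p →
      s 0 ≡ initState × (∀ t → StepAt s e p t) ×
      Σ (Proc n) λ q → Σ ℕ λ T → ∀ t → T ≤ t → ¬ Enabled (s t) (e t) q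

  HasDeadlock : ℕ → Set
  HasDeadlock n = LocallyDeadlockedRun n ⊎ GloballyDeadlockedRun n

-- Add the new copy B₀ of B in its initial state. Since init_B lies in every guard, B₀ never
-- blocks anyone, and since guards are conjunctive, a process enabled in the larger system is
-- already enabled in the smaller one. A local deadlock therefore survives with B₀ idle. After a
-- global deadlock the old processes are frozen, so B₀ runs alone against a fixed context: its
-- deterministic walk through the finitely many states of B either gets stuck (a global deadlock)
-- or runs forever while A stays disabled (a local deadlock).
module Submission where

open import Defs
open import Data.Bool using (true)
open import Data.Bool.Properties using () renaming (_≟_ to _≟ᵇ_)
open import Data.Empty using (⊥-elim)
open import Data.Fin using (Fin; toℕ) renaming (zero to fzero; suc to fsuc)
open import Data.Fin.Properties using (all?; pigeonhole; toℕ<n) renaming (_≟_ to _≟ᶠ_)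
open import Data.List.Membership.Propositional using (_∈_; find; lose)
open import Data.List.Relation.Unary.Any using (any?)
open import Data.Nat using (ℕ; zero; suc; _+_; _∸_; _≤_; _<_; _<?_; z≤n; s≤s; z<s; s<s)
open import Data.Nat.GeneralisedArithmetic using (fold; fold-+)
open import Data.Nat.Induction using (<-rec)
open import Data.Nat.Properties
  using (m∸n+n≡m; ≮⇒≥; +-monoʳ-<; <-trans; n<1+n; m<1+n⇒m<n∨m≡n; m≤n+m; m≤m+n; m+n∸m≡n; module ≤-Reasoning)
open import Data.Product using (Σ; ∃; _×_; _,_; proj₁; proj₂)
open import Data.Sum using (_⊎_; inj₁; inj₂; [_,_]′)
open import Function using (_∘_)
open import Relation.Binary.PropositionalEquality as ≡ using (_≡_; _≢_; refl; cong; subst; module ≡-Reasoning)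
open import Relation.Nullary using (¬_; Dec; yes; no)
open import Relation.Nullary.Decidable using (_×-dec_)

module _ {a} {X : Set a} (f : X → X) (x : X) where

  fold-shift : ∀ {i j} → fold x f i ≡ fold x f j → ∀ m → fold x f (m + i) ≡ fold x f (m + j)
  fold-shift {i} {j} eq m = begin
    fold x f (m + i)       ≡⟨ fold-+ x f m ⟩
    fold (fold x f i) f m  ≡⟨ cong (λ y → fold y f m) eq ⟩
    fold (fold x f j) f m  ≡⟨ ≡.sym (fold-+ x f m) ⟩
    fold x f (m + j)       ∎
    where open ≡-Reasoning

  fold-periodic : ∀ {i j} → i < j → fold x f i ≡ fold x f j →
                  ∀ t → ∃ λ t′ → t′ < j × fold x f t ≡ fold x f t′
  fold-periodic {i} {j} i<j eq = <-rec _ reduce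
    where
    reduce : ∀ t → (∀ {u} → u < t → ∃ λ t′ → t′ < j × fold x f u ≡ fold x f t′) →
             ∃ λ t′ → t′ < j × fold x f t ≡ fold x f t′
    reduce t earlier with t <? j
    ... | yes t<j = t , t<j , refl
    ... | no t≮j  = let t′ , t′<j , eq′ = earlier m+i<t in t′ , t′<j , ≡.trans t≡m+i eq′
      where
      m = t ∸ j
      m+j≡t : m + j ≡ t
      m+j≡t = m∸n+n≡m (≮⇒≥ t≮j)
      m+i<t : m + i < t
      m+i<t = begin-strict m + i <⟨ +-monoʳ-< m i<j ⟩ m + j ≡⟨ m+j≡t ⟩ t ∎
        where open ≤-Reasoning
      t≡m+i : fold x f t ≡ fold x f (m + i)
      t≡m+i = ≡.trans (cong (fold x f) (≡.sym m+j≡t)) (≡.sym (fold-shift eq m))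

fold-finite : ∀ {k} (f : Fin k → Fin k) x t → ∃ λ t′ → t′ < suc k × fold x f t ≡ fold x f t′
fold-finite {k} f x t =
  let i , j , i<j , eq = pigeonhole (n<1+n k) (fold x f ∘ toℕ)
      t′ , t′<j , eq′ = fold-periodic f x i<j eq t
  in t′ , <-trans t′<j (toℕ<n j) , eq′

first-or-all< : ∀ {p q} {P : ℕ → Set p} {Q : ℕ → Set q} → (∀ t → Q t ⊎ P t) →
                ∀ m → (∃ λ T → Q T × (∀ t → t < T → P t)) ⊎ (∀ t → t < m → P t)
first-or-all< decide zero = inj₂ λ _ ()
first-or-all< {P = P} decide (suc m) with first-or-all< decide m
... | inj₁ first = inj₁ first
... | inj₂ before with decide m
...   | inj₁ q = inj₁ (m , q , before)
...   | inj₂ p = inj₂ λ t t<1+m →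
          [ before t , (λ t≡m → subst P (≡.sym t≡m) p) ]′ (m<1+n⇒m<n∨m≡n t<1+m)

StuckWalk : ∀ {k} → (Fin k → Fin k → Set) → (Fin k → Set) → Fin k → Set
StuckWalk {k} R Stuck x₀ = Σ ℕ λ T → Σ (ℕ → Fin k) λ x →
  x 0 ≡ x₀ × (∀ t → t < T → R (x t) (x (suc t))) × Stuck (x T)

InfiniteWalk : ∀ {k} → (Fin k → Fin k → Set) → Fin k → Set
InfiniteWalk {k} R x₀ = Σ (ℕ → Fin k) λ x → x 0 ≡ x₀ × (∀ t → R (x t) (x (suc t)))

module _ {k : ℕ} {R : Fin k → Fin k → Set} {Stuck : Fin k → Set}
         (next : ∀ y → Stuck y ⊎ ∃ (R y)) where

  successor : Fin k → Fin k
  successor y = [ (λ _ → y) , proj₁ ]′ (next y)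

  stuck-or-successor : ∀ y → Stuck y ⊎ R y (successor y)
  stuck-or-successor y with next y
  ... | inj₁ stuck      = inj₁ stuck
  ... | inj₂ (_ , step) = inj₂ step

  stuckWalk-or-infiniteWalk : ∀ x₀ → StuckWalk R Stuck x₀ ⊎ InfiniteWalk R x₀
  stuckWalk-or-infiniteWalk x₀ with first-or-all< (stuck-or-successor ∘ fold x₀ successor) (suc k)
  ... | inj₁ (T , stuck , steps) = inj₁ (T , fold x₀ successor , refl , steps , stuck)
  ... | inj₂ steps = inj₂ (fold x₀ successor , refl , λ t →
          let t′ , t′<1+k , eq = fold-finite successor x₀ t
          in subst (λ y → R y (successor y)) (≡.sym eq) (steps t′ t′<1+k))

splice : ∀ {a} {X : Set a} → ℕ → (ℕ → X) → (ℕ → X) → ℕ → X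
splice zero    u v t       = v t
splice (suc k) u v zero    = u 0
splice (suc k) u v (suc t) = splice k (u ∘ suc) v t

module _ {a} {X : Set a} where

  splice-≤ : ∀ k {u v : ℕ → X} {t} → u k ≡ v 0 → t ≤ k → splice k u v t ≡ u t
  splice-≤ zero    join z≤n       = ≡.sym join
  splice-≤ (suc k) join z≤n       = refl
  splice-≤ (suc k) join (s≤s t≤k) = splice-≤ k join t≤k

  splice-≥ : ∀ k {u v : ℕ → X} {t} → k ≤ t → splice k u v t ≡ v (t ∸ k)
  splice-≥ zero    _         = refl
  splice-≥ (suc k) (s≤s k≤t) = splice-≥ k k≤t

module _ {c ℓ r} {C : Set c} {L : Set ℓ} (R : C → L → C → Set r) where

  splice-steps : ∀ k {u v : ℕ → C} {l m : ℕ → L} {T} →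
                 (∀ t → t < k → R (u t) (l t) (u (suc t))) → u k ≡ v 0 →
                 (∀ t → t < T → R (v t) (m t) (v (suc t))) →
                 ∀ t → t < k + T → R (splice k u v t) (splice k l m t) (splice k u v (suc t))
  splice-steps zero    prefix join suffix = suffix
  splice-steps (suc k) {u} {l = l} prefix join suffix zero _ =
    subst (R (u 0) (l 0)) (≡.sym (splice-≤ k join z≤n)) (prefix 0 z<s)
  splice-steps (suc k) prefix join suffix (suc t) (s<s t<k+T) =
    splice-steps k (λ t → prefix (suc t) ∘ s<s) join suffix t t<k+T

  splice-steps-∞ : ∀ k {u v : ℕ → C} {l m : ℕ → L} →
                   (∀ t → t < k → R (u t) (l t) (u (suc t))) → u k ≡ v 0 →
                   (∀ t → R (v t) (m t) (v (suc t))) →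
                   ∀ t → R (splice k u v t) (splice k l m t) (splice k u v (suc t))
  splice-steps-∞ k prefix join suffix t =
    splice-steps k {T = suc t} prefix join (λ t _ → suffix t) t (m≤n+m (suc t) k)

module Conjunctive {kA kB : ℕ} (A : Template kA kB kA) (B : Template kA kB kB) where
  open System A B

  infix 4 _≐_
  _≐_ : ∀ {n} → GState n → GState n → Set
  s ≐ s′ = ∀ p → s p ≡ s′ p

  Config : ℕ → Set
  Config n = GState n × GInput n

  Enabledᶜ : ∀ {n} → Config n → Proc n → Set
  Enabledᶜ c = Enabled (proj₁ c) (proj₂ c)

  Move : ∀ {n} → Config n → Proc n → Config n → Set
  Move c p c′ = Step (proj₁ c) (proj₂ c) p (proj₁ c′) × (∀ q → q ≢ p → proj₂ c′ q ≡ proj₂ c q)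

  module _ {n : ℕ} where

    TransEnabled-resp : ∀ {s s′ : GState n} {e p τ} → s ≐ s′ → TransEnabled s e p τ → TransEnabled s′ e p τ
    TransEnabled-resp {p = p} {τ} s≐s′ (src≡ , sym≡ , guards) =
      ≡.trans src≡ (s≐s′ p) , sym≡ ,
      λ q q≢p → subst (λ y → guard τ (loc q y) ≡ true) (s≐s′ q) (guards q q≢p)

    Enabled-resp : ∀ {s s′ : GState n} {e p} → s ≐ s′ → Enabled s e p → Enabled s′ e p
    Enabled-resp {e = e} {p} s≐s′ (τ , τ∈ , enabled) = τ , τ∈ , TransEnabled-resp {e = e} {p} {τ} s≐s′ enabled

    Step-respˡ : ∀ {s s′ s″ : GState n} {e p} → s ≐ s′ → Step s e p s″ → Step s′ e p s″
    Step-respˡ {e = e} {p} s≐s′ (τ , τ∈ , enabled , tgt≡ , frame) =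
      τ , τ∈ , TransEnabled-resp {e = e} {p} {τ} s≐s′ enabled , tgt≡ ,
      λ q q≢p → ≡.trans (frame q q≢p) (s≐s′ q)

    -- Without function extensionality the states built below equal initState only pointwise,
    -- whereas a run must start in initState itself.
    anchor : (ℕ → Config n) → ℕ → GState n
    anchor c zero    = initState
    anchor c (suc t) = proj₁ (c (suc t))

    module _ {c : ℕ → Config n} (c₀ : proj₁ (c 0) ≐ initState) where

      anchor-≐ : ∀ t → anchor c t ≐ proj₁ (c t)
      anchor-≐ zero    p = ≡.sym (c₀ p)
      anchor-≐ (suc t) p = refl

      anchor-Move : ∀ {p} t → Move (c t) p (c (suc t)) →
                    Move (anchor c t , proj₂ (c t)) p (anchor c (suc t) , proj₂ (c (suc t)))
      anchor-Move {p} zero (step , inputs) =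
        Step-respˡ {proj₁ (c 0)} {e = proj₂ (c 0)} {p} (λ q → ≡.sym (anchor-≐ zero q)) step , inputs
      anchor-Move (suc t) move = move

      globallyDeadlocked : ∀ k (P : ℕ → Proc n) → (∀ t → t < k → Move (c t) (P t) (c (suc t))) →
                           (∀ q → ¬ Enabledᶜ (c k) q) → GloballyDeadlockedRun n
      globallyDeadlocked k P moves dead =
        k , anchor c , proj₂ ∘ c , P , refl ,
        (λ t t<k → anchor-Move t (moves t t<k)) ,
        λ q → dead q ∘ Enabled-resp {e = proj₂ (c k)} {q} (anchor-≐ k)

      locallyDeadlocked : ∀ (P : ℕ → Proc n) → (∀ t → Move (c t) (P t) (c (suc t))) →
                          ∀ q T → (∀ t → T ≤ t → ¬ Enabledᶜ (c t) q) → LocallyDeadlockedRun n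
      locallyDeadlocked P moves q T disabled =
        anchor c , proj₂ ∘ c , P , refl , (λ t → anchor-Move t (moves t)) ,
        q , T , λ t T≤t → disabled t T≤t ∘ Enabled-resp {e = proj₂ (c t)} {q} (anchor-≐ t)

  module _ {n : ℕ} where

    lift : Proc n → Proc (suc n)
    lift pA     = pA
    lift (pB i) = pB (fsuc i)

    new : Proc (suc n)
    new = pB fzero

    infixl 6 _⊕ₛ_ _⊕ᵢ_
    _⊕ₛ_ : GState n → Fin kB → GState (suc n)
    (s ⊕ₛ b) pA            = s pA
    (s ⊕ₛ b) (pB fzero)    = b
    (s ⊕ₛ b) (pB (fsuc i)) = s (pB i)

    _⊕ᵢ_ : GInput n → Fin (nΣ B) → GInput (suc n)
    (e ⊕ᵢ σ) pA            = e pA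
    (e ⊕ᵢ σ) (pB fzero)    = σ
    (e ⊕ᵢ σ) (pB (fsuc i)) = e (pB i)

    initState-⊕ₛ : ∀ {s} → s ≡ initState → s ⊕ₛ init B ≐ initState
    initState-⊕ₛ refl pA            = refl
    initState-⊕ₛ refl (pB fzero)    = refl
    initState-⊕ₛ refl (pB (fsuc i)) = refl

    all-Proc? : ∀ {ℓ} {P : Proc n → Set ℓ} → (∀ q → Dec (P q)) → Dec (∀ q → P q)
    all-Proc? P? with P? pA | all? (P? ∘ pB)
    ... | yes PA | yes PB = yes λ { pA → PA ; (pB i) → PB i }
    ... | no ¬PA | _      = no λ P → ¬PA (P pA)
    ... | _      | no ¬PB = no λ P → ¬PB (P ∘ pB)

    initB-in-guard : InitInGuards A B → ∀ p {τ} → τ ∈ δ (tmpl {n} p) → guard τ (inj₂ (init B)) ≡ true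
    initB-in-guard initInGuards pA     τ∈ = proj₂ (proj₁ initInGuards _ τ∈)
    initB-in-guard initInGuards (pB _) τ∈ = proj₂ (proj₂ initInGuards _ τ∈)

    module _ {s : GState n} {g : Guard kA kB} where

      lift-guards : ∀ p → g (inj₂ (init B)) ≡ true → (∀ q → q ≢ p → g (loc q (s q)) ≡ true) →
                    ∀ q → q ≢ lift p → g (loc q ((s ⊕ₛ init B) q)) ≡ true
      lift-guards pA     _      old pA            q≢p = ⊥-elim (q≢p refl)
      lift-guards pA     g-init old (pB fzero)    _   = g-init
      lift-guards pA     _      old (pB (fsuc i)) _   = old (pB i) λ ()
      lift-guards (pB j) _      old pA            _   = old pA λ ()
      lift-guards (pB j) g-init old (pB fzero)    _   = g-init
      lift-guards (pB j) _      old (pB (fsuc i)) q≢p = old (pB i) λ { refl → q≢p refl }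

      lift-guards⁻¹ : ∀ {b} p → (∀ q → q ≢ lift p → g (loc q ((s ⊕ₛ b) q)) ≡ true) →
                      ∀ q → q ≢ p → g (loc q (s q)) ≡ true
      lift-guards⁻¹ pA     guards pA     q≢p = ⊥-elim (q≢p refl)
      lift-guards⁻¹ pA     guards (pB i) _   = guards (pB (fsuc i)) λ ()
      lift-guards⁻¹ (pB j) guards pA     _   = guards pA λ ()
      lift-guards⁻¹ (pB j) guards (pB i) q≢p = guards (pB (fsuc i)) λ { refl → q≢p refl }

      new-guards : ∀ {b} → (∀ q → g (loc q (s q)) ≡ true) → ∀ q → q ≢ new → g (loc q ((s ⊕ₛ b) q)) ≡ true
      new-guards old pA            _   = old pA
      new-guards old (pB fzero)    q≢p = ⊥-elim (q≢p refl)
      new-guards old (pB (fsuc i)) _   = old (pB i)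

      new-guards⁻¹ : ∀ {b} → (∀ q → q ≢ new → g (loc q ((s ⊕ₛ b) q)) ≡ true) → ∀ q → g (loc q (s q)) ≡ true
      new-guards⁻¹ guards pA     = guards pA λ ()
      new-guards⁻¹ guards (pB i) = guards (pB (fsuc i)) λ ()

    lift-frameₛ : ∀ {s s′ : GState n} {b} p → (∀ q → q ≢ p → s′ q ≡ s q) →
                  ∀ q → q ≢ lift p → (s′ ⊕ₛ b) q ≡ (s ⊕ₛ b) q
    lift-frameₛ pA     frame pA            q≢p = ⊥-elim (q≢p refl)
    lift-frameₛ pA     frame (pB fzero)    _   = refl
    lift-frameₛ pA     frame (pB (fsuc i)) _   = frame (pB i) λ ()
    lift-frameₛ (pB j) frame pA            _   = frame pA λ ()
    lift-frameₛ (pB j) frame (pB fzero)    _   = refl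
    lift-frameₛ (pB j) frame (pB (fsuc i)) q≢p = frame (pB i) λ { refl → q≢p refl }

    lift-frameᵢ : ∀ {e e′ : GInput n} {σ} p → (∀ q → q ≢ p → e′ q ≡ e q) →
                  ∀ q → q ≢ lift p → (e′ ⊕ᵢ σ) q ≡ (e ⊕ᵢ σ) q
    lift-frameᵢ pA     frame pA            q≢p = ⊥-elim (q≢p refl)
    lift-frameᵢ pA     frame (pB fzero)    _   = refl
    lift-frameᵢ pA     frame (pB (fsuc i)) _   = frame (pB i) λ ()
    lift-frameᵢ (pB j) frame pA            _   = frame pA λ ()
    lift-frameᵢ (pB j) frame (pB fzero)    _   = refl
    lift-frameᵢ (pB j) frame (pB (fsuc i)) q≢p = frame (pB i) λ { refl → q≢p refl }

    new-frame : ∀ {s : GState n} {b b′} → ∀ q → q ≢ new → (s ⊕ₛ b′) q ≡ (s ⊕ₛ b) q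
    new-frame pA            _   = refl
    new-frame (pB fzero)    q≢p = ⊥-elim (q≢p refl)
    new-frame (pB (fsuc i)) _   = refl

  module Extension {n : ℕ} (σ : Fin (nΣ B)) where

    infixl 6 _⊕_
    _⊕_ : Config n → Fin kB → Config (suc n)
    c ⊕ b = proj₁ c ⊕ₛ b , proj₂ c ⊕ᵢ σ

    Move-lift : InitInGuards A B → ∀ {c c′} p → Move c p c′ → Move (c ⊕ init B) (lift p) (c′ ⊕ init B)
    Move-lift initInGuards {c} pA ((τ , τ∈ , (src≡ , sym≡ , guards) , tgt≡ , frame) , inputs) =
      (τ , τ∈ ,
       (src≡ , sym≡ , lift-guards {s = proj₁ c} {g = guard τ} pA (initB-in-guard {n} initInGuards pA τ∈) guards) ,
       tgt≡ , lift-frameₛ pA frame) ,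
      lift-frameᵢ pA inputs
    Move-lift initInGuards {c} (pB j) ((τ , τ∈ , (src≡ , sym≡ , guards) , tgt≡ , frame) , inputs) =
      (τ , τ∈ ,
       (src≡ , sym≡ , lift-guards {s = proj₁ c} {g = guard τ} (pB j) (initB-in-guard initInGuards (pB j) τ∈) guards) ,
       tgt≡ , lift-frameₛ (pB j) frame) ,
      lift-frameᵢ (pB j) inputs

    Enabled-lift⁻¹ : ∀ {c b} p → Enabledᶜ (c ⊕ b) (lift p) → Enabledᶜ c p
    Enabled-lift⁻¹ {c} {b} pA (τ , τ∈ , src≡ , sym≡ , guards) =
      τ , τ∈ , src≡ , sym≡ , lift-guards⁻¹ {s = proj₁ c} {g = guard τ} {b = b} pA guards
    Enabled-lift⁻¹ {c} {b} (pB j) (τ , τ∈ , src≡ , sym≡ , guards) =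
      τ , τ∈ , src≡ , sym≡ , lift-guards⁻¹ {s = proj₁ c} {g = guard τ} {b = b} (pB j) guards

    NewEnabled : Config n → Fin kB → Transition kA kB kB (nΣ B) → Set
    NewEnabled c b τ = src τ ≡ b × Transition.sym τ ≡ σ × (∀ q → guard τ (loc q (proj₁ c q)) ≡ true)

    NewStep : Config n → Fin kB → Fin kB → Set
    NewStep c b b′ = Σ _ λ τ → τ ∈ δ B × NewEnabled c b τ × b′ ≡ tgt τ

    NewStuck : Config n → Fin kB → Set
    NewStuck c b = ∀ τ → τ ∈ δ B → ¬ NewEnabled c b τ

    NewEnabled? : ∀ c b τ → Dec (NewEnabled c b τ)
    NewEnabled? c b τ =
      (src τ ≟ᶠ b) ×-dec (Transition.sym τ ≟ᶠ σ) ×-dec all-Proc? (λ q → guard τ (loc q (proj₁ c q)) ≟ᵇ true)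

    new-stuck-or-step : ∀ c b → NewStuck c b ⊎ ∃ (NewStep c b)
    new-stuck-or-step c b with any? (NewEnabled? c b) (δ B)
    ... | yes some = let τ , τ∈ , enabled = find some in inj₂ (tgt τ , τ , τ∈ , enabled , refl)
    ... | no none  = inj₁ λ τ τ∈ enabled → none (lose τ∈ enabled)

    Move-new : ∀ {c b b′} → NewStep c b b′ → Move (c ⊕ b) new (c ⊕ b′)
    Move-new {c} {b} (τ , τ∈ , (src≡ , sym≡ , guards) , tgt≡) =
      (τ , τ∈ , (src≡ , sym≡ , new-guards {s = proj₁ c} {g = guard τ} {b = b} guards) , tgt≡ , new-frame) ,
      λ _ _ → refl

    new-disabled : ∀ {c b} → NewStuck c b → ¬ Enabledᶜ (c ⊕ b) new
    new-disabled {c} {b} stuck (τ , τ∈ , src≡ , sym≡ , guards) =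
      stuck τ τ∈ (src≡ , sym≡ , new-guards⁻¹ {s = proj₁ c} {g = guard τ} {b = b} guards)

    ⊕-deadlocked : ∀ {c b} → (∀ q → ¬ Enabledᶜ c q) → NewStuck c b → ∀ q → ¬ Enabledᶜ (c ⊕ b) q
    ⊕-deadlocked {c} {b} dead stuck pA            = dead pA ∘ Enabled-lift⁻¹ {c} {b} pA
    ⊕-deadlocked {c} {b} dead stuck (pB fzero)    = new-disabled {c} {b} stuck
    ⊕-deadlocked {c} {b} dead stuck (pB (fsuc i)) = dead (pB i) ∘ Enabled-lift⁻¹ {c} {b} (pB i)

    module _ (initInGuards : InitInGuards A B) where

      from-local-deadlock : LocallyDeadlockedRun n → LocallyDeadlockedRun (suc n)
      from-local-deadlock (s , e , p , s₀ , steps , q , T , disabled) =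
        locallyDeadlocked {c = λ t → (s t , e t) ⊕ init B} (initState-⊕ₛ s₀) (lift ∘ p)
          (λ t → Move-lift initInGuards (p t) (steps t)) (lift q) T
          (λ t T≤t → disabled t T≤t ∘ Enabled-lift⁻¹ {s t , e t} {init B} q)

      module AfterGlobalDeadlock {k} {c : ℕ → Config n} {P : ℕ → Proc n} (c₀ : proj₁ (c 0) ≡ initState)
        (moves : ∀ t → t < k → Move (c t) (P t) (c (suc t))) (dead : ∀ q → ¬ Enabledᶜ (c k) q)
        {x : ℕ → Fin kB} (x₀ : x 0 ≡ init B) where

        run : ℕ → Config (suc n)
        run = splice k (λ t → c t ⊕ init B) (λ t → c k ⊕ x t)

        labels : ℕ → Proc (suc n)
        labels = splice k (lift ∘ P) (λ _ → new)

        join : c k ⊕ init B ≡ c k ⊕ x 0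
        join = cong (c k ⊕_) (≡.sym x₀)

        run₀ : proj₁ (run 0) ≐ initState
        run₀ = subst (λ c′ → proj₁ c′ ≐ initState) (≡.sym (splice-≤ k join z≤n)) (initState-⊕ₛ c₀)

        lifted-moves : ∀ t → t < k → Move (c t ⊕ init B) (lift (P t)) (c (suc t) ⊕ init B)
        lifted-moves t t<k = Move-lift initInGuards (P t) (moves t t<k)

        stuckWalk⇒globallyDeadlocked : ∀ {T} → (∀ t → t < T → NewStep (c k) (x t) (x (suc t))) →
                                       NewStuck (c k) (x T) → GloballyDeadlockedRun (suc n)
        stuckWalk⇒globallyDeadlocked {T} walk stuck =
          globallyDeadlocked {c = run} run₀ (k + T) labels
            (splice-steps (Move {suc n}) k lifted-moves join (λ t t<T → Move-new (walk t t<T)))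
            (subst (λ c′ → ∀ q → ¬ Enabledᶜ c′ q) (≡.sym end) (⊕-deadlocked dead stuck))
          where
          end : run (k + T) ≡ c k ⊕ x T
          end = ≡.trans (splice-≥ k (m≤m+n k T)) (cong (λ t → c k ⊕ x t) (m+n∸m≡n k T))

        infiniteWalk⇒locallyDeadlocked : (∀ t → NewStep (c k) (x t) (x (suc t))) → LocallyDeadlockedRun (suc n)
        infiniteWalk⇒locallyDeadlocked walk =
          locallyDeadlocked {c = run} run₀ labels
            (splice-steps-∞ (Move {suc n}) k lifted-moves join (Move-new ∘ walk)) pA k
            (λ t k≤t → subst (λ c′ → ¬ Enabledᶜ c′ pA) (≡.sym (splice-≥ k k≤t))
                         (dead pA ∘ Enabled-lift⁻¹ {c k} {x (t ∸ k)} pA))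

      from-global-deadlock : GloballyDeadlockedRun n → HasDeadlock (suc n)
      from-global-deadlock (k , s , e , p , s₀ , steps , dead)
        with stuckWalk-or-infiniteWalk (new-stuck-or-step (s k , e k)) (init B)
      ... | inj₁ (T , x , x₀ , walk , stuck) =
        inj₂ (AfterGlobalDeadlock.stuckWalk⇒globallyDeadlocked s₀ steps dead x₀ walk stuck)
      ... | inj₂ (x , x₀ , walk) =
        inj₁ (AfterGlobalDeadlock.infiniteWalk⇒locallyDeadlocked s₀ steps dead x₀ walk)

      HasDeadlock-suc : HasDeadlock n → HasDeadlock (suc n)
      HasDeadlock-suc (inj₁ local)  = inj₁ (from-local-deadlock local)
      HasDeadlock-suc (inj₂ global) = from-global-deadlock global

  -- The alphabet of B may be empty; this is where n ≥ 1 is needed.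
  letter-of-B : ∀ {n} → HasDeadlock (suc n) → Fin (nΣ B)
  letter-of-B (inj₁ (_ , e , _))     = e 0 (pB fzero)
  letter-of-B (inj₂ (_ , _ , e , _)) = e 0 (pB fzero)

lemma11 : ∀ {kA kB : ℕ} (A : Template kA kB kA) (B : Template kA kB kB) →
          InitInGuards A B →
          ∀ (n : ℕ) → 1 ≤ n →
          System.HasDeadlock A B n → System.HasDeadlock A B (suc n)
lemma11 A B initInGuards (suc n) _ deadlock =
  Extension.HasDeadlock-suc (letter-of-B deadlock) initInGuards deadlock
  where open Conjunctive A B
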